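{- Let $\lambda_1>\mu_1$ be positive integers and let $r(\lambda_1,\mu_1)=\min\{z\in\mathbb{N}: z\ge\lambda_1,\ \gcd(z,\mu_1)=1\}$. Then the pair $(\lambda_1,\mu_1)$ is $r(\lambda_1,\mu_1)$-initial. In particular, $(\lambda_1,\mu_1)$ is $(\lambda_1+\mu_1-1)$-initial.
   Context: For a positive integer $r$, a partition with at most $r$ parts is written as a non-increasing $r$-tuple of nonnegative integers; $\mathrm{Par}_r(n)$ is the set of such tuples with entries summing to $n$. For $\lambda,\mu\in\mathrm{Par}_r(n)$, $\lambda$ dominates $\mu$ if $\sum_{i=1}^k\lambda_i\ge\sum_{i=1}^k\mu_i$ for all $k\le r$. The $r$-Kostka cone $\mathcal{K}_r\subseteq\mathbb{R}^{2r}$ is the convex hull of all points $(\lambda_1,\dots,\lambda_r,\mu_1,\dots,\mu_r)$ with $\lambda,\mu\in\mathrm{Par}_r(n)$ for some $n$ and $\lambda$ dominating $\mu$; it is a pointed rational polyhedral cone. Its Hilbert basis is the unique minimal finite set of integer points of $\mathcal{K}_r$ such that every integer point of $\mathcal{K}_r$ is a nonnegative integer combination of them; equivalently, the set of integer points of $\mathcal{K}_r$ that are not nonnegative integer combinations of other integer points of $\mathcal{K}_r$. An integer pair $(\lambda_1,\mu_1)$ is called $r$-initial if there is an element $(\lambda,\mu)$ of the Hilbert basis of $\mathcal{K}_r$ such that the first entry of $\lambda$ is $\lambda_1$ and the first entry of $\mu$ is $\mu_1$. -}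

module Defs where

open import Data.Nat using (ℕ; zero; suc; _+_; _≤_)
open import Data.Fin using (Fin) renaming (_≤_ to _≤ᶠ_)
open import Data.Vec using (Vec; lookup; toList; zipWith; replicate)
open import Data.List using (List; []; _∷_; take; foldr; head)
open import Data.Nat.ListAction using (sum)
open import Data.List.Relation.Unary.All using (All)
open import Data.Maybe using (just)
open import Data.Product using (Σ; _×_; _,_)
open import Relation.Binary.PropositionalEquality using (_≡_; _≢_)
open import Relation.Nullary using (¬_)

-- A partition with at most r parts: a non-increasing r-tuple of naturals.
NonIncreasing : {r : ℕ} → Vec ℕ r → Set
NonIncreasing {r} v = (i j : Fin r) → i ≤ᶠ j → lookup v j ≤ lookup v i

∣_∣ᵥ : {r : ℕ} → Vec ℕ r → ℕ
∣ v ∣ᵥ = sum (toList v)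

Dominates : {r : ℕ} → Vec ℕ r → Vec ℕ r → Set
Dominates {r} lam mu = (k : ℕ) → k ≤ r → sum (take k (toList mu)) ≤ sum (take k (toList lam))

-- Points of ℤ^{2r} written as (λ , μ); all integer points of K_r have
-- nonnegative coordinates, so ℕ-coordinates suffice.
Point : ℕ → Set
Point r = Vec ℕ r × Vec ℕ r

KostkaPoint : (r : ℕ) → Point r → Set
KostkaPoint r (lam , mu) =
  NonIncreasing lam × NonIncreasing mu × ∣ lam ∣ᵥ ≡ ∣ mu ∣ᵥ × Dominates lam mu

_⊕_ : {r : ℕ} → Point r → Point r → Point r
(a , b) ⊕ (c , d) = zipWith _+_ a c , zipWith _+_ b d

𝟘 : {r : ℕ} → Point r
𝟘 {r} = replicate r 0 , replicate r 0

-- sum of a finite list of points (a nonnegative integer combination,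
-- with coefficients encoded as repetitions)
sumPts : {r : ℕ} → List (Point r) → Point r
sumPts = foldr _⊕_ 𝟘

ReducibleIn : (r : ℕ) → Point r → Set
ReducibleIn r x = Σ (List (Point r)) λ ys →
  All (λ y → KostkaPoint r y × y ≢ x) ys × sumPts ys ≡ x

InHilbertBasis : (r : ℕ) → Point r → Set
InHilbertBasis r x = KostkaPoint r x × ¬ ReducibleIn r x

Initial : (r : ℕ) → ℕ → ℕ → Set
Initial r l1 m1 = Σ (Point r) λ x → InHilbertBasis r x ×
  (head (toList (Data.Product.proj₁ x)) ≡ just l1) ×
  (head (toList (Data.Product.proj₂ x)) ≡ just m1)

open import Data.Nat.GCD using (gcd)
IsRMin : ℕ → ℕ → ℕ → Set
IsRMin l1 m1 z = l1 ≤ z × gcd z m1 ≡ 1 × ((w : ℕ) → l1 ≤ w → gcd w m1 ≡ 1 → z ≤ w)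

{-# OPTIONS --safe #-}
-- Let m < l ≤ z < l + m with gcd(z, m) = 1, and write z = n + m, l = n + p.  The point
-- λ = (l^m), μ = (m^n, p^m) lies in the Kostka cone of every dimension r ≥ z, and it is an atom
-- of the monoid of its integer points.  Indeed, if (a, b) + (c, d) = (λ, μ), monotonicity forces
-- a to be constant on the m parts of λ and b to be constant on each of the two blocks of μ, say
-- a = (A^m) and b = (B^n, B′^m).  Then |a| = |b| reads z B = m (A + B − B′), so m ∣ B, and as
-- B ≤ μ₁ = m, either B = 0 and (a, b) = 0, or B = m and (c, d) = 0.  Atoms are in the Hilbert
-- basis.  Such a z exists below l + m because any m consecutive integers contain one coprime
-- to m, so both r(l, m) and l + m − 1 are admissible dimensions.
module Submission where

open import Defs
open import Function using (_∘_)
open import Data.Nat using (ℕ; zero; suc; _+_; _*_; _∸_; _<_; _≤_; z≤n; s≤s; _≤?_; _<?_)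
open import Data.Nat.Properties
open import Data.Nat.Tactic.RingSolver using (solve-∀)
open import Algebra.Properties.CommutativeSemigroup +-commutativeSemigroup using (interchange)
open import Data.Nat.Coprimality as Coprime using (Coprime; coprime-divisor; coprime-+; 1-coprimeTo; gcd≡1⇒coprime; coprime⇒gcd≡1)
open import Data.Nat.Divisibility using (_∣_; divides; ∣⇒≤)
open import Data.Fin using (Fin; toℕ; fromℕ<) renaming (zero to fzero; suc to fsuc)
open import Data.Fin.Properties using (toℕ-fromℕ<)
open import Data.Vec using (Vec; []; _∷_; lookup; toList; zipWith; replicate; tabulate)
open import Data.Vec.Properties using (lookup-zipWith; lookup∘tabulate; lookup-replicate; zipWith-identityˡ; zipWith-identityʳ)
open import Data.List using (List; []; _∷_; take)
open import Data.Nat.ListAction using (sum)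
open import Data.List.Relation.Unary.All as All using (All; []; _∷_)
open import Data.Maybe using (just)
open import Data.Product using (∃; _×_; _,_; proj₁; proj₂)
open import Data.Sum using (_⊎_; inj₁; inj₂)
open import Relation.Binary.PropositionalEquality
open import Relation.Nullary using (¬_; yes; no; contradiction)

∑< : ℕ → (ℕ → ℕ) → ℕ
∑< zero    f = 0
∑< (suc n) f = f 0 + ∑< n (f ∘ suc)

box : ℕ → ℕ → ℕ → ℕ
box zero    A k       = 0
box (suc n) A zero    = A
box (suc n) A (suc k) = box n A k

∑<-+ : ∀ n (f g : ℕ → ℕ) → ∑< n (λ k → f k + g k) ≡ ∑< n f + ∑< n g
∑<-+ zero    f g = refl
∑<-+ (suc n) f g = trans (cong (f 0 + g 0 +_) (∑<-+ n (f ∘ suc) (g ∘ suc)))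
                         (interchange (f 0) (g 0) _ _)

∑<-mono : ∀ n {f g : ℕ → ℕ} → (∀ k → k < n → f k ≤ g k) → ∑< n f ≤ ∑< n g
∑<-mono zero    f≤g = z≤n
∑<-mono (suc n) f≤g = +-mono-≤ (f≤g 0 (s≤s z≤n)) (∑<-mono n (λ k k<n → f≤g (suc k) (s≤s k<n)))

∑<-monoˡ : ∀ {m n} (f : ℕ → ℕ) → m ≤ n → ∑< m f ≤ ∑< n f
∑<-monoˡ f z≤n       = z≤n
∑<-monoˡ f (s≤s m≤n) = +-monoʳ-≤ (f 0) (∑<-monoˡ (f ∘ suc) m≤n)

∑<-box : ∀ {n r} A → n ≤ r → ∑< r (box n A) ≡ n * A
∑<-box {zero}  {r}     A _         = ∑<-zero r
  where
  ∑<-zero : ∀ r → ∑< r (λ _ → 0) ≡ 0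
  ∑<-zero zero    = refl
  ∑<-zero (suc r) = ∑<-zero r
∑<-box {suc n} {suc r} A (s≤s n≤r) = cong (A +_) (∑<-box A n≤r)

box-< : ∀ {n k} A → k < n → box n A k ≡ A
box-< {suc n} {zero}  A _         = refl
box-< {suc n} {suc k} A (s≤s k<n) = box-< A k<n

box-≥ : ∀ {n k} A → n ≤ k → box n A k ≡ 0
box-≥ {zero}            A _         = refl
box-≥ {suc n} {suc k}   A (s≤s n≤k) = box-≥ A n≤k

box-≤ : ∀ n A k → box n A k ≤ A
box-≤ zero    A k       = z≤n
box-≤ (suc n) A zero    = ≤-refl
box-≤ (suc n) A (suc k) = box-≤ n A k

box-antitone : ∀ n A {k k′} → k ≤ k′ → box n A k′ ≤ box n A k
box-antitone zero    A _         = z≤n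
box-antitone (suc n) A {zero} {zero}   _         = ≤-refl
box-antitone (suc n) A {zero} {suc k′} _         = box-≤ n A k′
box-antitone (suc n) A {suc k} {suc k′} (s≤s k≤k′) = box-antitone n A k≤k′

box-dominates : ∀ {m r l} (g : ℕ → ℕ) → m ≤ r → (∀ k → g k ≤ l) → ∑< r g ≡ m * l →
                ∀ k → k ≤ r → ∑< k g ≤ ∑< k (box m l)
box-dominates {m} {r} {l} g m≤r g≤l ∑g k k≤r with k ≤? m
... | yes k≤m = ∑<-mono k (λ j j<k → ≤-trans (g≤l j) (≤-reflexive (sym (box-< l (<-≤-trans j<k k≤m)))))
... | no  k≰m = begin
  ∑< k g          ≤⟨ ∑<-monoˡ g k≤r ⟩
  ∑< r g          ≡⟨ ∑g ⟩
  m * l           ≡⟨ ∑<-box l (<⇒≤ (≰⇒> k≰m)) ⟨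
  ∑< k (box m l)  ∎
  where open ≤-Reasoning

tabulateℕ : ∀ {r} → (ℕ → ℕ) → Vec ℕ r
tabulateℕ F = tabulate (F ∘ toℕ)

∣∣ᵥ-by-lookup : ∀ {r} (v : Vec ℕ r) (F : ℕ → ℕ) → (∀ i → lookup v i ≡ F (toℕ i)) → ∣ v ∣ᵥ ≡ ∑< r F
∣∣ᵥ-by-lookup []      F v≡F = refl
∣∣ᵥ-by-lookup (x ∷ v) F v≡F = cong₂ _+_ (v≡F fzero) (∣∣ᵥ-by-lookup v (F ∘ suc) (v≡F ∘ fsuc))

∣tabulateℕ∣ : ∀ r (F : ℕ → ℕ) → ∣ tabulateℕ {r} F ∣ᵥ ≡ ∑< r F
∣tabulateℕ∣ r F = ∣∣ᵥ-by-lookup (tabulateℕ {r} F) F (lookup∘tabulate (F ∘ toℕ))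

sum-take-tabulateℕ : ∀ {k r} (F : ℕ → ℕ) → k ≤ r → sum (take k (toList (tabulateℕ {r} F))) ≡ ∑< k F
sum-take-tabulateℕ {zero}          F _         = refl
sum-take-tabulateℕ {suc k} {suc r} F (s≤s k≤r) = cong (F 0 +_) (sum-take-tabulateℕ (F ∘ suc) k≤r)

tabulateℕ-nonIncreasing : ∀ {r} (F : ℕ → ℕ) → (∀ {k k′} → k ≤ k′ → F k′ ≤ F k) →
                          NonIncreasing (tabulateℕ {r} F)
tabulateℕ-nonIncreasing F antitone i j i≤j
  rewrite lookup∘tabulate (F ∘ toℕ) i | lookup∘tabulate (F ∘ toℕ) j = antitone i≤j

lookup-+-tabulateℕ : ∀ {r} {a c : Vec ℕ r} (F : ℕ → ℕ) → zipWith _+_ a c ≡ tabulateℕ F →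
                     ∀ i → lookup a i + lookup c i ≡ F (toℕ i)
lookup-+-tabulateℕ {a = a} {c} F eq i = begin
  lookup a i + lookup c i       ≡⟨ lookup-zipWith _+_ i a c ⟨
  lookup (zipWith _+_ a c) i    ≡⟨ cong (λ v → lookup v i) eq ⟩
  lookup (tabulateℕ F) i        ≡⟨ lookup∘tabulate (F ∘ toℕ) i ⟩
  F (toℕ i)                     ∎
  where open ≡-Reasoning

∣∣ᵥ-zipWith : ∀ {r} (a c : Vec ℕ r) → ∣ zipWith _+_ a c ∣ᵥ ≡ ∣ a ∣ᵥ + ∣ c ∣ᵥ
∣∣ᵥ-zipWith []      []      = refl
∣∣ᵥ-zipWith (x ∷ a) (y ∷ c) = trans (cong (x + y +_) (∣∣ᵥ-zipWith a c)) (interchange x y _ _)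

sum-take-zipWith : ∀ {r} k (a c : Vec ℕ r) →
  sum (take k (toList (zipWith _+_ a c))) ≡ sum (take k (toList a)) + sum (take k (toList c))
sum-take-zipWith zero    a       c       = refl
sum-take-zipWith (suc k) []      []      = refl
sum-take-zipWith (suc k) (x ∷ a) (y ∷ c) =
  trans (cong (x + y +_) (sum-take-zipWith k a c)) (interchange x y _ _)

sum-take-replicate : ∀ {r} k → sum (take k (toList (replicate r 0))) ≡ 0
sum-take-replicate         zero    = refl
sum-take-replicate {zero}  (suc k) = refl
sum-take-replicate {suc r} (suc k) = sum-take-replicate {r} k

nonIncreasing-zipWith : ∀ {r} (a c : Vec ℕ r) → NonIncreasing a → NonIncreasing c →
                        NonIncreasing (zipWith _+_ a c)
nonIncreasing-zipWith a c na nc i j i≤j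
  rewrite lookup-zipWith _+_ i a c | lookup-zipWith _+_ j a c = +-mono-≤ (na i j i≤j) (nc i j i≤j)

nonIncreasing-replicate : ∀ r → NonIncreasing (replicate r 0)
nonIncreasing-replicate r i j _ rewrite lookup-replicate j 0 = z≤n

∣replicate∣ : ∀ r → ∣ replicate r 0 ∣ᵥ ≡ 0
∣replicate∣ zero    = refl
∣replicate∣ (suc r) = ∣replicate∣ r

∣∣ᵥ≡0⇒≡replicate : ∀ {r} (v : Vec ℕ r) → ∣ v ∣ᵥ ≡ 0 → v ≡ replicate r 0
∣∣ᵥ≡0⇒≡replicate []      _  = refl
∣∣ᵥ≡0⇒≡replicate (x ∷ v) eq = cong₂ _∷_ (m+n≡0⇒m≡0 x eq) (∣∣ᵥ≡0⇒≡replicate v (m+n≡0⇒n≡0 x eq))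

nonIncreasing-head≡0⇒≡replicate : ∀ {r} (v : Vec ℕ (suc r)) → NonIncreasing v → lookup v fzero ≡ 0 →
                                  v ≡ replicate (suc r) 0
nonIncreasing-head≡0⇒≡replicate {r} v nv v₀≡0 = ≗replicate v (λ i → n≤0⇒n≡0 (subst (lookup v i ≤_) v₀≡0 (nv fzero i z≤n)))
  where
  ≗replicate : ∀ {n} (w : Vec ℕ n) → (∀ i → lookup w i ≡ 0) → w ≡ replicate n 0
  ≗replicate []      _ = refl
  ≗replicate (x ∷ w) h = cong₂ _∷_ (h fzero) (≗replicate w (h ∘ fsuc))

KostkaPoint-𝟘 : ∀ r → KostkaPoint r 𝟘
KostkaPoint-𝟘 r = nonIncreasing-replicate r , nonIncreasing-replicate r , refl ,
                  λ k _ → ≤-reflexive (trans (sum-take-replicate {r} k) (sym (sum-take-replicate {r} k)))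

KostkaPoint-⊕ : ∀ {r} {x y : Point r} → KostkaPoint r x → KostkaPoint r y → KostkaPoint r (x ⊕ y)
KostkaPoint-⊕ {x = a , b} {c , d} (na , nb , ∣a∣≡∣b∣ , a≽b) (nc , nd , ∣c∣≡∣d∣ , c≽d) =
  nonIncreasing-zipWith a c na nc , nonIncreasing-zipWith b d nb nd ,
  trans (∣∣ᵥ-zipWith a c) (trans (cong₂ _+_ ∣a∣≡∣b∣ ∣c∣≡∣d∣) (sym (∣∣ᵥ-zipWith b d))) ,
  λ k k≤r → subst₂ _≤_ (sym (sum-take-zipWith k b d)) (sym (sum-take-zipWith k a c))
                       (+-mono-≤ (a≽b k k≤r) (c≽d k k≤r))

KostkaPoint-sumPts : ∀ {r} {ys : List (Point r)} → All (KostkaPoint r) ys → KostkaPoint r (sumPts ys)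
KostkaPoint-sumPts {r} []         = KostkaPoint-𝟘 r
KostkaPoint-sumPts     (ky ∷ kys) = KostkaPoint-⊕ ky (KostkaPoint-sumPts kys)

⊕-identityˡ : ∀ {r} (x : Point r) → 𝟘 ⊕ x ≡ x
⊕-identityˡ (a , b) = cong₂ _,_ (zipWith-identityˡ +-identityˡ a) (zipWith-identityˡ +-identityˡ b)

⊕-identityʳ : ∀ {r} (x : Point r) → x ⊕ 𝟘 ≡ x
⊕-identityʳ (a , b) = cong₂ _,_ (zipWith-identityʳ +-identityʳ a) (zipWith-identityʳ +-identityʳ b)

Atom : (r : ℕ) → Point r → Set
Atom r x = x ≢ 𝟘 × (∀ y y′ → KostkaPoint r y → KostkaPoint r y′ → y ⊕ y′ ≡ x → y ≡ 𝟘 ⊎ y′ ≡ 𝟘)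

atom⇒¬reducible : ∀ {r} {x : Point r} → Atom r x → ¬ ReducibleIn r x
atom⇒¬reducible {r} {x} (x≢𝟘 , split) (ys , valid , ∑ys≡x) = go ys valid ∑ys≡x
  where
  go : ∀ ys → All (λ y → KostkaPoint r y × y ≢ x) ys → sumPts ys ≢ x
  go []       _                 ∑≡x = x≢𝟘 (sym ∑≡x)
  go (y ∷ ys) ((ky , y≢x) ∷ vs) ∑≡x with split y (sumPts ys) ky (KostkaPoint-sumPts (All.map proj₁ vs)) ∑≡x
  ... | inj₁ y≡𝟘  = go ys vs (trans (sym (⊕-identityˡ (sumPts ys))) (trans (cong (_⊕ sumPts ys) (sym y≡𝟘)) ∑≡x))
  ... | inj₂ ∑≡𝟘 = y≢x (trans (sym (⊕-identityʳ y)) (trans (cong (y ⊕_) (sym ∑≡𝟘)) ∑≡x))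

module Summand {r} (F : ℕ → ℕ) (a c : Vec ℕ r) (na : NonIncreasing a) (nc : NonIncreasing c)
         (a+c≡F : ∀ i → lookup a i + lookup c i ≡ F (toℕ i)) where

  constant : ∀ {i j} → toℕ i ≤ toℕ j → F (toℕ i) ≡ F (toℕ j) → lookup a j ≡ lookup a i
  constant {i} {j} i≤j Fi≡Fj = ≤-antisym (na i j i≤j) (+-cancelʳ-≤ (lookup c i) _ _ (begin
    lookup a i + lookup c i  ≡⟨ trans (a+c≡F i) (trans Fi≡Fj (sym (a+c≡F j))) ⟩
    lookup a j + lookup c j  ≤⟨ +-monoʳ-≤ (lookup a j) (nc i j i≤j) ⟩
    lookup a j + lookup c i  ∎))
    where open ≤-Reasoning

  vanishes : ∀ {j} → F (toℕ j) ≡ 0 → lookup a j ≡ 0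
  vanishes {j} Fj≡0 = m+n≡0⇒m≡0 (lookup a j) (trans (a+c≡F j) Fj≡0)

∣∧≤⇒≡0⊎≡ : ∀ {m n} → m ∣ n → n ≤ m → n ≡ 0 ⊎ n ≡ m
∣∧≤⇒≡0⊎≡ {n = zero}  _   _   = inj₁ refl
∣∧≤⇒≡0⊎≡ {n = suc n} m∣n n≤m = inj₂ (≤-antisym n≤m (∣⇒≤ m∣n))

-- λ = (l^m) and μ = (m^n, p^m), where m = q + p, l = n + p and z = n + m; the parts of μ are
-- written as box n q + box z p so that no subtraction occurs.  The dimension is suc r so that
-- the first parts are read off at fzero.
module Construction (q p n r : ℕ) (q<n : q < n) (0<m : 0 < q + p)
                    (z≤r : n + (q + p) ≤ suc r) (m⊥z : Coprime (q + p) (n + (q + p))) where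

  m l z : ℕ
  m = q + p
  l = n + p
  z = n + m

  lamAt muAt : ℕ → ℕ
  lamAt = box m l
  muAt k = box n q k + box z p k

  lam mu : Vec ℕ (suc r)
  lam = tabulateℕ lamAt
  mu  = tabulateℕ muAt

  n<z : n < z
  n<z = m<m+n n 0<m

  m≤r : m ≤ suc r
  m≤r = ≤-trans (m≤n+m m n) z≤r

  n<r : n < suc r
  n<r = <-≤-trans n<z z≤r

  n≤r : n ≤ suc r
  n≤r = <⇒≤ n<r

  muAt-< : ∀ {k} → k < n → muAt k ≡ m
  muAt-< k<n = cong₂ _+_ (box-< q k<n) (box-< p (<-trans k<n n<z))

  muAt-mid : ∀ {k} → n ≤ k → k < z → muAt k ≡ p
  muAt-mid n≤k k<z = cong₂ _+_ (box-≥ q n≤k) (box-< p k<z)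

  muAt-≥ : ∀ {k} → z ≤ k → muAt k ≡ 0
  muAt-≥ z≤k = cong₂ _+_ (box-≥ q (≤-trans (<⇒≤ n<z) z≤k)) (box-≥ p z≤k)

  muAt-≤ : ∀ k → muAt k ≤ m
  muAt-≤ k = +-mono-≤ (box-≤ n q k) (box-≤ z p k)

  muAt₀ : muAt 0 ≡ m
  muAt₀ = muAt-< (≤-<-trans z≤n q<n)

  ∑lamAt : ∑< (suc r) lamAt ≡ m * l
  ∑lamAt = ∑<-box l m≤r

  ∑muAt : ∑< (suc r) muAt ≡ m * l
  ∑muAt = begin
    ∑< (suc r) muAt                              ≡⟨ ∑<-+ (suc r) (box n q) (box z p) ⟩
    ∑< (suc r) (box n q) + ∑< (suc r) (box z p)  ≡⟨ cong₂ _+_ (∑<-box q n≤r) (∑<-box p z≤r) ⟩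
    n * q + (n + (q + p)) * p                    ≡⟨ identity q p n ⟩
    (q + p) * (n + p)                            ∎
    where
    open ≡-Reasoning
    identity : ∀ q p n → n * q + (n + (q + p)) * p ≡ (q + p) * (n + p)
    identity = solve-∀

  ∣lam∣≡∣mu∣ : ∣ lam ∣ᵥ ≡ ∣ mu ∣ᵥ
  ∣lam∣≡∣mu∣ = trans (∣tabulateℕ∣ (suc r) lamAt) (trans ∑lamAt (sym (trans (∣tabulateℕ∣ (suc r) muAt) ∑muAt)))

  kostka : KostkaPoint (suc r) (lam , mu)
  kostka = tabulateℕ-nonIncreasing lamAt (box-antitone m l) ,
           tabulateℕ-nonIncreasing muAt (λ k≤k′ → +-mono-≤ (box-antitone n q k≤k′) (box-antitone z p k≤k′)) ,
           ∣lam∣≡∣mu∣ ,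
           λ k k≤r → subst₂ _≤_ (sym (sum-take-tabulateℕ muAt k≤r)) (sym (sum-take-tabulateℕ lamAt k≤r))
                       (box-dominates muAt m≤r (λ k → ≤-trans (muAt-≤ k) (+-monoˡ-≤ p (<⇒≤ q<n))) ∑muAt k k≤r)

  module Split {a b c d : Vec ℕ (suc r)} (na : NonIncreasing a) (nb : NonIncreasing b)
               (nc : NonIncreasing c) (nd : NonIncreasing d) (∣a∣≡∣b∣ : ∣ a ∣ᵥ ≡ ∣ b ∣ᵥ)
               (a+c≡lam : zipWith _+_ a c ≡ lam) (b+d≡mu : zipWith _+_ b d ≡ mu) where

    a+c≡lamAt : ∀ i → lookup a i + lookup c i ≡ lamAt (toℕ i)
    a+c≡lamAt = lookup-+-tabulateℕ lamAt a+c≡lam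

    b+d≡muAt : ∀ i → lookup b i + lookup d i ≡ muAt (toℕ i)
    b+d≡muAt = lookup-+-tabulateℕ muAt b+d≡mu

    module a+c = Summand lamAt a c na nc a+c≡lamAt
    module b+d = Summand muAt b d nb nd b+d≡muAt

    iₙ : Fin (suc r)
    iₙ = fromℕ< n<r

    toℕ-iₙ : toℕ iₙ ≡ n
    toℕ-iₙ = toℕ-fromℕ< n<r

    A B B′ t : ℕ
    A  = lookup a fzero
    B  = lookup b fzero
    B′ = lookup b iₙ
    t  = B ∸ B′

    B′≤B : B′ ≤ B
    B′≤B = nb fzero iₙ z≤n

    a≡box : ∀ j → lookup a j ≡ box m A (toℕ j)
    a≡box j with toℕ j <? m
    ... | yes j<m = trans (a+c.constant z≤n (trans (box-< l 0<m) (sym (box-< l j<m))))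
                          (sym (box-< A j<m))
    ... | no  j≮m = trans (a+c.vanishes (box-≥ l (≮⇒≥ j≮m))) (sym (box-≥ A (≮⇒≥ j≮m)))

    b≡box+box : ∀ j → lookup b j ≡ box n t (toℕ j) + box z B′ (toℕ j)
    b≡box+box j with toℕ j <? n | toℕ j <? z
    ... | yes j<n | _
      rewrite box-< t j<n | box-< B′ (<-trans j<n n<z) =
        trans (b+d.constant z≤n (trans muAt₀ (sym (muAt-< j<n)))) (sym (m∸n+n≡m B′≤B))
    ... | no j≮n | yes j<z
      rewrite box-≥ t (≮⇒≥ j≮n) | box-< B′ j<z =
        b+d.constant (subst (_≤ toℕ j) (sym toℕ-iₙ) (≮⇒≥ j≮n))
          (trans (cong muAt toℕ-iₙ) (trans (muAt-mid ≤-refl n<z) (sym (muAt-mid (≮⇒≥ j≮n) j<z))))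
    ... | no j≮n | no j≮z
      rewrite box-≥ t (≮⇒≥ j≮n) | box-≥ B′ (≮⇒≥ j≮z) =
        b+d.vanishes (muAt-≥ (≮⇒≥ j≮z))

    ∣a∣≡m*A : ∣ a ∣ᵥ ≡ m * A
    ∣a∣≡m*A = trans (∣∣ᵥ-by-lookup a (box m A) a≡box) (∑<-box A m≤r)

    ∣b∣≡n*t+z*B′ : ∣ b ∣ᵥ ≡ n * t + z * B′
    ∣b∣≡n*t+z*B′ = begin
      ∣ b ∣ᵥ                                       ≡⟨ ∣∣ᵥ-by-lookup b (λ k → box n t k + box z B′ k) b≡box+box ⟩
      ∑< (suc r) (λ k → box n t k + box z B′ k)    ≡⟨ ∑<-+ (suc r) (box n t) (box z B′) ⟩
      ∑< (suc r) (box n t) + ∑< (suc r) (box z B′) ≡⟨ cong₂ _+_ (∑<-box t n≤r) (∑<-box B′ z≤r) ⟩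
      n * t + z * B′                               ∎
      where open ≡-Reasoning

    z*B≡m*[A+t] : z * B ≡ m * (A + t)
    z*B≡m*[A+t] = begin
      z * B                     ≡⟨ cong (z *_) (m∸n+n≡m B′≤B) ⟨
      z * (t + B′)              ≡⟨ identity n m t B′ ⟩
      (n * t + z * B′) + m * t  ≡⟨ cong (_+ m * t) (trans (sym ∣b∣≡n*t+z*B′) (trans (sym ∣a∣≡∣b∣) ∣a∣≡m*A)) ⟩
      m * A + m * t             ≡⟨ *-distribˡ-+ m A t ⟨
      m * (A + t)               ∎
      where
      open ≡-Reasoning
      identity : ∀ n m t B′ → (n + m) * (t + B′) ≡ (n * t + (n + m) * B′) + m * t
      identity = solve-∀

    B≤m : B ≤ m
    B≤m = ≤-trans (m≤m+n B (lookup d fzero)) (≤-reflexive (trans (b+d≡muAt fzero) muAt₀))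

    B≡0⊎B≡m : B ≡ 0 ⊎ B ≡ m
    B≡0⊎B≡m = ∣∧≤⇒≡0⊎≡ (coprime-divisor m⊥z (divides (A + t) (trans z*B≡m*[A+t] (*-comm m (A + t))))) B≤m

    summand≡𝟘 : (a , b) ≡ 𝟘 ⊎ (c , d) ≡ 𝟘
    summand≡𝟘 with B≡0⊎B≡m
    ... | inj₁ B≡0 = inj₁ (cong₂ _,_ a≡0 b≡0)
      where
      b≡0 : b ≡ replicate (suc r) 0
      b≡0 = nonIncreasing-head≡0⇒≡replicate b nb B≡0
      a≡0 : a ≡ replicate (suc r) 0
      a≡0 = ∣∣ᵥ≡0⇒≡replicate a (trans ∣a∣≡∣b∣ (trans (cong ∣_∣ᵥ b≡0) (∣replicate∣ (suc r))))
    ... | inj₂ B≡m = inj₂ (cong₂ _,_ c≡0 d≡0)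
      where
      d₀≡0 : lookup d fzero ≡ 0
      d₀≡0 = +-cancelˡ-≡ B _ _ (trans (b+d≡muAt fzero) (trans muAt₀ (trans (sym B≡m) (sym (+-identityʳ B)))))
      d≡0 : d ≡ replicate (suc r) 0
      d≡0 = nonIncreasing-head≡0⇒≡replicate d nd d₀≡0
      ∣c∣≡0 : ∣ c ∣ᵥ ≡ 0
      ∣c∣≡0 = +-cancelˡ-≡ ∣ a ∣ᵥ _ _ (begin
        ∣ a ∣ᵥ + ∣ c ∣ᵥ       ≡⟨ ∣∣ᵥ-zipWith a c ⟨
        ∣ zipWith _+_ a c ∣ᵥ  ≡⟨ cong ∣_∣ᵥ a+c≡lam ⟩
        ∣ lam ∣ᵥ              ≡⟨ ∣lam∣≡∣mu∣ ⟩
        ∣ mu ∣ᵥ               ≡⟨ cong ∣_∣ᵥ b+d≡mu ⟨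
        ∣ zipWith _+_ b d ∣ᵥ  ≡⟨ ∣∣ᵥ-zipWith b d ⟩
        ∣ b ∣ᵥ + ∣ d ∣ᵥ       ≡⟨ cong₂ _+_ (sym ∣a∣≡∣b∣) (trans (cong ∣_∣ᵥ d≡0) (∣replicate∣ (suc r))) ⟩
        ∣ a ∣ᵥ + 0            ∎)
        where open ≡-Reasoning
      c≡0 : c ≡ replicate (suc r) 0
      c≡0 = ∣∣ᵥ≡0⇒≡replicate c ∣c∣≡0

  atom : Atom (suc r) (lam , mu)
  atom = lam≢𝟘 , λ { (a , b) (c , d) (na , nb , ∣a∣≡∣b∣ , _) (nc , nd , _ , _) eq →
                      Split.summand≡𝟘 na nb nc nd ∣a∣≡∣b∣ (cong proj₁ eq) (cong proj₂ eq) }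
    where
    lam≢𝟘 : (lam , mu) ≢ 𝟘
    lam≢𝟘 eq = <⇒≢ (<-≤-trans (≤-<-trans z≤n q<n) (m≤m+n n p))
                   (sym (trans (sym (box-< l 0<m)) (cong (λ x → lookup (proj₁ x) fzero) eq)))

  initial : Initial (suc r) l m
  initial = (lam , mu) , (kostka , atom⇒¬reducible atom) , cong just (box-< l 0<m) , cong just muAt₀

initial-of-coprime : ∀ {l m z r} → 0 < m → m < l → l ≤ z → z < l + m → z ≤ r → Coprime z m → Initial r l m
initial-of-coprime {r = zero}  0<m m<l l≤z _ z≤0 _ = contradiction (<-≤-trans m<l (≤-trans l≤z z≤0)) n≮0
initial-of-coprime {l} {m} {z} {suc r} 0<m m<l l≤z z<l+m z≤r z⊥m =
  subst₂ (Initial (suc r)) n+p≡l q+p≡m (Construction.initial q p n r q<n 0<q+p z≤r′ m⊥z)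
  where
  q p n : ℕ
  q = z ∸ l
  p = m ∸ q
  n = z ∸ m
  q+p≡m : q + p ≡ m
  q+p≡m = m+[n∸m]≡n (m≤n+o⇒m∸n≤o z l (<⇒≤ z<l+m))
  n+m≡z : n + m ≡ z
  n+m≡z = m∸n+n≡m (<⇒≤ (<-≤-trans m<l l≤z))
  n+p≡l : n + p ≡ l
  n+p≡l = +-cancelʳ-≡ q (n + p) l (begin
    n + p + q    ≡⟨ trans (+-assoc n p q) (cong (n +_) (trans (+-comm p q) q+p≡m)) ⟩
    n + m        ≡⟨ n+m≡z ⟩
    z            ≡⟨ m+[n∸m]≡n l≤z ⟨
    l + q        ∎)
    where open ≡-Reasoning
  q<n : q < n
  q<n = +-cancelʳ-< p q n (subst₂ _<_ (sym q+p≡m) (sym n+p≡l) m<l)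
  0<q+p : 0 < q + p
  0<q+p = subst (0 <_) (sym q+p≡m) 0<m
  z≤r′ : n + (q + p) ≤ suc r
  z≤r′ = subst (_≤ suc r) (sym (trans (cong (n +_) q+p≡m) n+m≡z)) z≤r
  m⊥z : Coprime (q + p) (n + (q + p))
  m⊥z = subst₂ Coprime (sym q+p≡m) (sym (trans (cong (n +_) q+p≡m) n+m≡z)) (Coprime.sym z⊥m)

-- Moving the window one step drops only n + 1, and n + 1 + m is coprime to m whenever n + 1 is.
coprime-in-window : ∀ m → 0 < m → ∀ n → ∃ λ w → Coprime w m × n < w × w ≤ n + m
coprime-in-window m 0<m zero = 1 , 1-coprimeTo m , s≤s z≤n , 0<m
coprime-in-window m 0<m (suc n) with coprime-in-window m 0<m n
... | w , w⊥m , n<w , w≤n+m with m≤n⇒m<n∨m≡n n<w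
...   | inj₁ 1+n<w = w , w⊥m , 1+n<w , ≤-trans w≤n+m (n≤1+n (n + m))
...   | inj₂ refl  = m + suc n , coprime-+ w⊥m , m<n+m (suc n) 0<m , ≤-reflexive (+-comm m (suc n))

theorem6p7 : (l1 m1 : ℕ) → 0 < m1 → m1 < l1 →
    ((z : ℕ) → IsRMin l1 m1 z → Initial z l1 m1) × Initial (l1 + m1 ∸ 1) l1 m1
theorem6p7 zero      m1 0<m ()
theorem6p7 (suc l-1) m1 0<m m<l with coprime-in-window m1 0<m l-1
... | w , w⊥m , l≤w , w≤l+m-1 =
  (λ { z (l≤z , gcd≡1 , minimal) →
         initial-of-coprime 0<m m<l l≤z (s≤s (≤-trans (minimal w l≤w (coprime⇒gcd≡1 w⊥m)) w≤l+m-1))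
                            ≤-refl (gcd≡1⇒coprime gcd≡1) }) ,
  initial-of-coprime 0<m m<l l≤w (s≤s w≤l+m-1) w≤l+m-1 w⊥m
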